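{- Let $R$ be a set of requests on a bidirected tree $T$ rooted at some vertex, let $R^-,R^+,R^\vee$ be the sets of converging, diverging and unimodal requests of $R$, and let $I\subseteq R$ be a set of pairwise non-interfering requests. Then either $I$ contains exactly two unimodal requests, or $|I\cap(R^+\cup R^\vee)|\le 1$, or $|I\cap(R^-\cup R^\vee)|\le 1$.
   Context: A bidirected tree $T$ is a digraph obtained from a finite undirected tree by replacing each edge $uv$ by the two arcs $(u,v)$ and $(v,u)$. A request in $T$ is a directed path in $T$ with at least one arc. For a directed path $r$, $s_r$ is its first vertex, $t_r$ its last vertex, $s_r^+$ its second vertex, $t_r^-$ its penultimate vertex; its emission arc is $(s_r,s_r^+)$ and its reception arc is $(t_r^-,t_r)$. $T[x,y]$ denotes the unique directed path from $x$ to $y$ in $T$. A request $r$ interferes on $r'$ if $T[s_r,t_{r'}]$ has first arc the emission arc of $r$ and last arc the reception arc of $r'$; two requests interfere if one interferes on the other. When $T$ is rooted at $z$, an arc is converging if directed towards $z$ and diverging otherwise; a directed path is converging (resp. diverging) if all its arcs are converging (resp. diverging), and unimodal otherwise. -}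

module Defs where

open import Data.Nat using (ℕ; suc; _≤_)
open import Data.Fin using (Fin; zero; suc; toℕ)
open import Data.List using (List; []; _∷_; _++_; length)
open import Data.List.Relation.Unary.Unique.Propositional using (Unique)
open import Data.Product using (Σ; _×_; ∃)
open import Data.Sum using (_⊎_)
open import Data.Unit using (⊤)
open import Relation.Nullary using (¬_)
open import Relation.Binary.PropositionalEquality using (_≡_)

-- A finite rooted tree, vertices Fin (suc n), root = zero.
-- Vertex (suc i) has parent (parent i), whose index is ≤ i
-- (every finite rooted tree admits such a labelling, e.g. BFS order).
record RootedTree : Set where
  field
    n        : ℕ
    parent   : Fin n → Fin (suc n)
    parent-≤ : ∀ i → toℕ (parent i) ≤ toℕ i

module _ (T : RootedTree) where
  open RootedTree T

  Vertex : Set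
  Vertex = Fin (suc n)

  ConvArc : Vertex → Vertex → Set
  ConvArc u v = Σ (Fin n) λ i → u ≡ suc i × v ≡ parent i

  DivArc : Vertex → Vertex → Set
  DivArc u v = ConvArc v u

  Arc : Vertex → Vertex → Set
  Arc u v = ConvArc u v ⊎ DivArc u v

AllArcs : {A : Set} → (A → A → Set) → List A → Set
AllArcs P []              = ⊤
AllArcs P (u ∷ [])        = ⊤
AllArcs P (u ∷ v ∷ rest)  = P u v × AllArcs P (v ∷ rest)

module _ (T : RootedTree) where

  IsDiPath : List (Vertex T) → Set
  IsDiPath p = AllArcs (Arc T) p × Unique p

  IsRequest : List (Vertex T) → Set
  IsRequest p = IsDiPath p × 2 ≤ length p

  Converging : List (Vertex T) → Set
  Converging p = AllArcs (ConvArc T) p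

  Diverging : List (Vertex T) → Set
  Diverging p = AllArcs (DivArc T) p

  Unimodal : List (Vertex T) → Set
  Unimodal p = ¬ Converging p × ¬ Diverging p

  FirstArc : List (Vertex T) → Vertex T → Vertex T → Set
  FirstArc p a b = ∃ λ rest → p ≡ a ∷ b ∷ rest

  LastArc : List (Vertex T) → Vertex T → Vertex T → Set
  LastArc p a b = ∃ λ init → p ≡ init ++ (a ∷ b ∷ [])

  -- r interferes on r': the (unique) directed path T[s_r, t_r'] has as first
  -- arc the emission arc of r and as last arc the reception arc of r'.
  -- A directed path q having those first/last arcs goes from s_r to t_r',
  -- hence is T[s_r, t_r'] by uniqueness of paths in a tree.
  InterferesOn : List (Vertex T) → List (Vertex T) → Set
  InterferesOn r r' =
    Σ (List (Vertex T)) λ q → IsDiPath q ×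
      (∃ λ a → ∃ λ b → FirstArc r a b × FirstArc q a b) ×
      (∃ λ c → ∃ λ d → LastArc r' c d × LastArc q c d)

  Interfere : List (Vertex T) → List (Vertex T) → Set
  Interfere r r' = InterferesOn r r' ⊎ InterferesOn r' r

-- Root the tree and orient requests by their extreme arcs: a converging or unimodal request
-- leaves its source s along a converging arc, a diverging or unimodal request enters its target
-- t along a diverging arc. Among pairwise non-interfering requests, (i) the sources of two
-- such "climbing" requests are incomparable for the ancestor order, since otherwise the lower
-- one interferes on the upper one; (ii) dually for the targets of two "descending" requests;
-- (iii) the source of a climbing request is comparable with the target of any other descending
-- request, since otherwise the path between them through their lowest common ancestor witnesses
-- interference. In a tree, (i)-(iii) cannot hold for climbing x ≠ x′ and descending y ≠ y′
-- with x ∉ {y, y′} and x′ ≠ y. Such a quadruple exists as soon as I contains three unimodal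
-- requests, or at most one unimodal request but two climbing and two descending ones.
module Submission where

open import Defs
open import Data.Empty using (⊥; ⊥-elim)
open import Data.Fin using (Fin; zero; suc; toℕ)
open import Data.Fin.Properties using (_≟_)
open import Data.List using (List; []; _∷_; _++_; _∷ʳ_; filter; deduplicate)
open import Data.List.Properties using (++-assoc; ≡-dec)
open import Data.List.Membership.Propositional using (_∈_; _∉_)
open import Data.List.Membership.Propositional.Properties
  using (∈-++⁺ʳ; ∈-++⁻; ∈-filter⁺; ∈-filter⁻; ∈-deduplicate⁺; ∈-deduplicate⁻)
open import Data.List.Relation.Binary.Subset.Propositional using (_⊆_)
open import Data.List.Relation.Unary.All as All using (All; []; _∷_)
open import Data.List.Relation.Unary.AllPairs using ([]; _∷_)
open import Data.List.Relation.Unary.Any using (here; there)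
open import Data.List.Relation.Unary.Any.Properties using (singleton⁻)
open import Data.List.Relation.Unary.Unique.Propositional using (Unique)
import Data.List.Relation.Unary.Unique.Propositional.Properties as Unique
open import Data.List.Relation.Unary.Unique.DecPropositional.Properties using (deduplicate-!)
open import Data.Nat using (zero; suc; _≤_; s≤s)
open import Data.Nat.Properties using (≤-refl; ≤-trans; n≤1+n; n≮n)
open import Data.Product using (Σ; _×_; _,_; proj₁; proj₂; ∃-syntax; ∃₂; map; map₂)
open import Data.Sum using (_⊎_; inj₁; inj₂; [_,_]; [_,_]′; swap)
open import Data.Unit using (tt)
open import Function using (_∘_; id)
open import Relation.Binary.Definitions using (DecidableEquality)
open import Relation.Binary.PropositionalEquality
  using (_≡_; _≢_; refl; sym; trans; cong; subst; subst₂)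
open import Relation.Nullary using (¬_; Dec; yes; no; ¬?; _×-dec_; _⊎-dec_)
open import Relation.Nullary.Decidable using (toSum)
open import Relation.Unary using (Decidable)

module _ {A : Set} where

  AllArcs-map : {P Q : A → A → Set} → (∀ {x y} → P x y → Q x y) →
                ∀ xs → AllArcs P xs → AllArcs Q xs
  AllArcs-map f []           _        = tt
  AllArcs-map f (x ∷ [])     _        = tt
  AllArcs-map f (x ∷ y ∷ xs) (p , ps) = f p , AllArcs-map f (y ∷ xs) ps

  AllArcs? : {P : A → A → Set} → (∀ x y → Dec (P x y)) → ∀ xs → Dec (AllArcs P xs)
  AllArcs? P? []           = yes tt
  AllArcs? P? (x ∷ [])     = yes tt
  AllArcs? P? (x ∷ y ∷ xs) = P? x y ×-dec AllArcs? P? (y ∷ xs)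

  module _ {P : A → A → Set} where

    AllArcs-++⁺ : ∀ {xs ys x y} → (∃[ init ] xs ≡ init ∷ʳ x) → (∃[ rest ] ys ≡ y ∷ rest) →
                  AllArcs P xs → P x y → AllArcs P ys → AllArcs P (xs ++ ys)
    AllArcs-++⁺ {x = x} {y} (init , refl) (rest , refl) = join init
      where
      join : ∀ zs → AllArcs P (zs ∷ʳ x) → P x y → AllArcs P (y ∷ rest) →
             AllArcs P ((zs ∷ʳ x) ++ y ∷ rest)
      join []           _        pxy ps′ = pxy , ps′
      join (z ∷ [])     (p , _)  pxy ps′ = p , pxy , ps′
      join (z ∷ z′ ∷ zs) (p , ps) pxy ps′ = p , join (z′ ∷ zs) ps pxy ps′

    AllArcs-++⁻ˡ : ∀ xs {ys} → AllArcs P (xs ++ ys) → AllArcs P xs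
    AllArcs-++⁻ˡ []           _        = tt
    AllArcs-++⁻ˡ (x ∷ [])     _        = tt
    AllArcs-++⁻ˡ (x ∷ y ∷ xs) (p , ps) = p , AllArcs-++⁻ˡ (y ∷ xs) ps

  ∉-before : ∀ (xs : List A) {y ys} → Unique (xs ++ y ∷ ys) → y ∉ xs
  ∉-before (x ∷ xs) (x∉ ∷ _) (here refl) = All.lookup x∉ (∈-++⁺ʳ xs (here refl)) refl
  ∉-before (x ∷ xs) (_ ∷ uq) (there y∈) = ∉-before xs uq y∈

  head-∈-init : ∀ init {a b c : A} {rest} → init ++ b ∷ c ∷ [] ≡ a ∷ rest → a ∈ init ∷ʳ b
  head-∈-init []       refl = here refl
  head-∈-init (_ ∷ _) refl = here refl

  module _ (P : A → Set) where

    TwoDistinct : List A → Set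
    TwoDistinct xs = ∃₂ λ x y → x ≢ y × (x ∈ xs × P x) × (y ∈ xs × P y)

    AllEqual : List A → Set
    AllEqual xs = ∀ {x y} → x ∈ xs → P x → y ∈ xs → P y → x ≡ y

    ExactlyTwo : List A → Set
    ExactlyTwo xs = Σ A λ x → Σ A λ y → x ≢ y × x ∈ xs × P x × y ∈ xs × P y ×
                    (∀ {z} → z ∈ xs → P z → z ≡ x ⊎ z ≡ y)

  twoDistinct⊎allEqual : DecidableEquality A → {P : A → Set} → Decidable P →
                         ∀ xs → TwoDistinct P xs ⊎ AllEqual P xs
  twoDistinct⊎allEqual _≟ᴬ_ {P} P? xs =
    fromCandidates (deduplicate _≟ᴬ_ (filter P? xs)) (deduplicate-! _≟ᴬ_ (filter P? xs))
      (λ x∈ px → ∈-deduplicate⁺ _≟ᴬ_ (∈-filter⁺ P? x∈ px))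
      (∈-filter⁻ P? ∘ ∈-deduplicate⁻ _≟ᴬ_ (filter P? xs))
    where
    fromCandidates : ∀ cs → Unique cs → (∀ {x} → x ∈ xs → P x → x ∈ cs) →
                     (∀ {x} → x ∈ cs → x ∈ xs × P x) → TwoDistinct P xs ⊎ AllEqual P xs
    fromCandidates [] _ complete _ = inj₂ λ x∈ px _ _ → ⊥-elim (∉[] (complete x∈ px))
      where
      ∉[] : ∀ {x} → x ∉ []
      ∉[] ()
    fromCandidates (c ∷ []) _ complete _ =
      inj₂ λ x∈ px y∈ py → trans (singleton⁻ (complete x∈ px)) (sym (singleton⁻ (complete y∈ py)))
    fromCandidates (c ∷ c′ ∷ _) ((c≢c′ ∷ _) ∷ _) _ sound =
      inj₁ (c , c′ , c≢c′ , sound (here refl) , sound (there (here refl)))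

  oneOutside : {P Q : A → Set} → Decidable Q → ∀ {xs} → AllEqual Q xs → TwoDistinct P xs →
               ∃₂ λ x y → x ≢ y × (x ∈ xs × P x × ¬ Q x) × (y ∈ xs × P y)
  oneOutside Q? Q-eq (x , y , x≢y , (x∈ , px) , (y∈ , py)) with Q? x | Q? y
  ... | no ¬qx | _      = x , y , x≢y , (x∈ , px , ¬qx) , (y∈ , py)
  ... | yes _  | no ¬qy = y , x , x≢y ∘ sym , (y∈ , py , ¬qy) , (x∈ , px)
  ... | yes qx | yes qy = ⊥-elim (x≢y (Q-eq x∈ qx y∈ qy))

module _ (T : RootedTree) where
  open RootedTree T

  private variable
    i j k k′ m m′ : Fin n
    u v w a a′ b b′ c d : Vertex T
    r r′ : List (Vertex T)

  infix 4 _≼_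
  data _≼_ (u : Vertex T) : Vertex T → Set where
    ≼-refl  : u ≼ u
    ≼-child : ∀ {i} → u ≼ parent i → u ≼ suc i

  Comparable : Vertex T → Vertex T → Set
  Comparable u v = u ≼ v ⊎ v ≼ u

  ≼⇒≤ : u ≼ v → toℕ u ≤ toℕ v
  ≼⇒≤ ≼-refl          = ≤-refl
  ≼⇒≤ (≼-child {i} p) = ≤-trans (≼⇒≤ p) (≤-trans (parent-≤ i) (n≤1+n _))

  parent≼child : parent i ≼ suc i
  parent≼child = ≼-child ≼-refl

  child⋠parent : ¬ suc i ≼ parent i
  child⋠parent {i} p = n≮n _ (≤-trans (≼⇒≤ p) (parent-≤ i))

  parent≢descendant : suc i ≼ v → parent i ≢ v
  parent≢descendant p refl = child⋠parent p

  ≼-trans : u ≼ v → v ≼ w → u ≼ w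
  ≼-trans p ≼-refl      = p
  ≼-trans p (≼-child q) = ≼-child (≼-trans p q)

  ≼-linear : u ≼ w → v ≼ w → Comparable u v
  ≼-linear ≼-refl      q           = inj₂ q
  ≼-linear (≼-child p) ≼-refl      = inj₁ (≼-child p)
  ≼-linear (≼-child p) (≼-child q) = ≼-linear p q

  ≼-of-incomparable : Comparable w a → Comparable w b → ¬ Comparable a b → w ≼ a
  ≼-of-incomparable (inj₁ w≼a) _          _   = w≼a
  ≼-of-incomparable (inj₂ a≼w) (inj₁ w≼b) a⋈b = ⊥-elim (a⋈b (inj₁ (≼-trans a≼w w≼b)))
  ≼-of-incomparable (inj₂ a≼w) (inj₂ b≼w) a⋈b = ⊥-elim (a⋈b (≼-linear a≼w b≼w))

  crossing-impossible : ¬ Comparable a a′ → ¬ Comparable b b′ →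
                        Comparable a b → Comparable a b′ → Comparable a′ b → ⊥
  crossing-impossible a⋈a′ b⋈b′ ab ab′ a′b =
    [ (λ a′≼b → a⋈a′ (inj₂ (≼-trans a′≼b b≼a))) , (λ b≼a′ → a⋈a′ (inj₁ (≼-trans a≼b b≼a′))) ] a′b
    where
    b≼a = ≼-of-incomparable (swap ab) (swap a′b) a⋈a′
    a≼b = ≼-of-incomparable ab ab′ b⋈b′

  child-toward : u ≼ v → u ≢ v → ∃[ i ] parent i ≡ u × suc i ≼ v
  child-toward ≼-refl u≢v = ⊥-elim (u≢v refl)
  child-toward {u} (≼-child {i} p) _ with u ≟ parent i
  ... | yes u≡pi = i , sym u≡pi , ≼-refl
  ... | no  u≢pi = map₂ (map₂ ≼-child) (child-toward p u≢pi)

  siblings-≡ : parent i ≡ parent j → suc i ≼ w → suc j ≼ w → i ≡ j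
  siblings-≡ e p q = [ lower e , sym ∘ lower (sym e) ] (≼-linear p q)
    where
    lower : ∀ {i j} → parent i ≡ parent j → suc i ≼ suc j → i ≡ j
    lower e ≼-refl      = refl
    lower e (≼-child p) = ⊥-elim (child⋠parent (subst (_ ≼_) (sym e) p))

  root≼ : ∀ v → zero ≼ v
  root≼ v = bounded (toℕ v) v ≤-refl
    where
    bounded : ∀ f v → toℕ v ≤ f → zero ≼ v
    bounded _       zero    _         = ≼-refl
    bounded zero    (suc i) ()
    bounded (suc f) (suc i) (s≤s i≤f) = ≼-child (bounded f (parent i) (≤-trans (parent-≤ i) i≤f))

  data Placement (a b : Vertex T) : Set where
    comparable : Comparable a b → Placement a b
    apart      : ∀ {i j} → i ≢ j → parent i ≡ parent j → suc i ≼ a → suc j ≼ b → Placement a b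

  placement : ∀ a b → Placement a b
  placement a b = from-root (root≼ b)
    where
    from-root : ∀ {v} → zero ≼ v → Placement a v
    from-root ≼-refl = comparable (inj₂ (root≼ a))
    from-root (≼-child {j} p) with from-root p
    ... | comparable (inj₁ a≼pj) = comparable (inj₁ (≼-child a≼pj))
    ... | apart i≢j e ia jb      = apart i≢j e ia (≼-child jb)
    ... | comparable (inj₂ pj≼a) with parent j ≟ a
    ...   | yes pj≡a = comparable (inj₁ (subst (_≼ suc j) pj≡a parent≼child))
    ...   | no  pj≢a with child-toward pj≼a pj≢a
    ...     | i , e , ia with i ≟ j
    ...       | yes refl = comparable (inj₂ ia)
    ...       | no  i≢j  = apart i≢j e ia ≼-refl

  up    : u ≼ v → List (Vertex T)
  above : u ≼ v → List (Vertex T)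
  up {v = v} p = v ∷ above p
  above ≼-refl      = []
  above (≼-child p) = up p

  down  : u ≼ v → List (Vertex T)
  below : u ≼ v → List (Vertex T)
  down {v = v} q = below q ∷ʳ v
  below ≼-refl      = []
  below (≼-child q) = down q

  up-last : (p : u ≼ v) → ∃[ init ] up p ≡ init ∷ʳ u
  up-last ≼-refl          = [] , refl
  up-last (≼-child {i} p) = map (suc i ∷_) (cong (suc i ∷_)) (up-last p)

  down-head : (q : u ≼ v) → ∃[ rest ] down q ≡ u ∷ rest
  down-head ≼-refl          = [] , refl
  down-head (≼-child {i} q) = map (_∷ʳ suc i) (cong (_∷ʳ suc i)) (down-head q)

  ∈-up : (p : u ≼ v) → w ∈ up p → u ≼ w × w ≼ v
  ∈-up ≼-refl      (here refl) = ≼-refl , ≼-refl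
  ∈-up (≼-child p) (here refl) = ≼-child p , ≼-refl
  ∈-up (≼-child p) (there w∈)  = map₂ ≼-child (∈-up p w∈)

  ∈-down : (q : u ≼ v) → w ∈ down q → u ≼ w × w ≼ v
  ∈-down ≼-refl      (here refl) = ≼-refl , ≼-refl
  ∈-down (≼-child q) w∈ with ∈-++⁻ (down q) w∈
  ... | inj₁ w∈q         = map₂ ≼-child (∈-down q w∈q)
  ... | inj₂ (here refl) = ≼-child q , ≼-refl

  up-converging : (p : u ≼ v) → Converging T (up p)
  up-converging ≼-refl          = tt
  up-converging (≼-child {i} p) = (i , refl , refl) , up-converging p

  down-diverging : (q : u ≼ v) → Diverging T (down q)
  down-diverging ≼-refl          = tt
  down-diverging (≼-child {i} q) =
    AllArcs-++⁺ (below q , refl) ([] , refl) (down-diverging q) (i , refl , refl) tt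

  up-isDiPath : (p : u ≼ v) → IsDiPath T (up p)
  up-isDiPath p = AllArcs-map inj₁ (up p) (up-converging p) , unique p
    where
    unique : (p : u ≼ v) → Unique (up p)
    unique ≼-refl      = [] ∷ []
    unique (≼-child p) =
      All.tabulate (λ w∈ e → child⋠parent (subst (_≼ _) (sym e) (proj₂ (∈-up p w∈)))) ∷ unique p

  down-isDiPath : (q : u ≼ v) → IsDiPath T (down q)
  down-isDiPath q = AllArcs-map inj₂ (down q) (down-diverging q) , unique q
    where
    unique : (q : u ≼ v) → Unique (down q)
    unique ≼-refl      = [] ∷ []
    unique (≼-child q) =
      Unique.++⁺ (unique q) ([] ∷ []) λ { (w∈ , here refl) → child⋠parent (proj₂ (∈-down q w∈)) }

  up-firstArc : (p : u ≼ suc k) → u ≢ suc k → FirstArc T (up p) (suc k) (parent k)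
  up-firstArc ≼-refl      u≢ = ⊥-elim (u≢ refl)
  up-firstArc (≼-child p) _  = above p , refl

  down-lastArc : (q : u ≼ suc m) → u ≢ suc m → LastArc T (down q) (parent m) (suc m)
  down-lastArc ≼-refl      u≢ = ⊥-elim (u≢ refl)
  down-lastArc (≼-child q) _  = below q , ++-assoc (below q) (parent _ ∷ []) (suc _ ∷ [])

  up-lastArc-via : (p : suc i ≼ v) → LastArc T (up (≼-trans parent≼child p)) (suc i) (parent i)
  up-lastArc-via ≼-refl          = [] , refl
  up-lastArc-via (≼-child {j} p) = map (suc j ∷_) (cong (suc j ∷_)) (up-lastArc-via p)

  down-firstArc-via : (q : suc i ≼ v) →
                      FirstArc T (down (≼-trans parent≼child q)) (parent i) (suc i)
  down-firstArc-via ≼-refl          = [] , refl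
  down-firstArc-via (≼-child {j} q) = map (_∷ʳ suc j) (cong (_∷ʳ suc j)) (down-firstArc-via q)

  LastArc-++ : ∀ xs → LastArc T r c d → LastArc T (xs ++ r) c d
  LastArc-++ xs (init , refl) = xs ++ init , sym (++-assoc xs init _)

  Route : (a b c d : Vertex T) → Set
  Route a b c d = Σ (List (Vertex T)) λ q → IsDiPath T q × FirstArc T q a b × LastArc T q c d

  route-up : suc i ≼ suc k → Route (suc k) (parent k) (suc i) (parent i)
  route-up p = up p′ , up-isDiPath p′ , up-firstArc p′ (parent≢descendant p) , up-lastArc-via p
    where p′ = ≼-trans parent≼child p

  route-down : suc i ≼ suc m → Route (parent i) (suc i) (parent m) (suc m)
  route-down q =
    down q′ , down-isDiPath q′ , down-firstArc-via q , down-lastArc q′ (parent≢descendant q)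
    where q′ = ≼-trans parent≼child q

  route-apart : i ≢ j → parent i ≡ parent j → suc i ≼ suc k → suc j ≼ suc m →
                Route (suc k) (parent k) (parent m) (suc m)
  route-apart {i} {j} i≢j e p q =
    up p ++ down q′ , (arcs , unique) , first p ,
    LastArc-++ (up p) (down-lastArc q′ (parent≢descendant q))
    where
    q′ : parent j ≼ _
    q′ = ≼-trans parent≼child q

    arcs : AllArcs (Arc T) (up p ++ down q′)
    arcs = AllArcs-++⁺ (up-last p) (down-head q′) (proj₁ (up-isDiPath p)) (inj₁ (i , refl , sym e))
                       (proj₁ (down-isDiPath q′))

    unique : Unique (up p ++ down q′)
    unique = Unique.++⁺ (proj₂ (up-isDiPath p)) (proj₂ (down-isDiPath q′)) λ (w∈up , w∈down) →
      i≢j (siblings-≡ e (≼-trans (proj₁ (∈-up p w∈up)) (proj₂ (∈-down q′ w∈down))) q)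

    first : ∀ {k} (p : suc i ≼ suc k) → FirstArc T (up p ++ down q′) (suc k) (parent k)
    first ≼-refl      =
      map id (λ eq → cong (suc i ∷_) (trans eq (cong (_∷ _) (sym e)))) (down-head q′)
    first (≼-child p) = above p ++ down q′ , refl

  convArc-asym : ConvArc T u v → ¬ ConvArc T v u
  convArc-asym (_ , refl , refl) (_ , e₁ , e₂) =
    child⋠parent (subst₂ _≼_ (sym e₂) (sym e₁) parent≼child)

  down-then-up-backtracks : DivArc T u v → ConvArc T v w → u ≡ w
  down-then-up-backtracks (_ , refl , refl) (_ , refl , refl) = refl

  ≼-across-arc : Arc T v w → u ≼ v → u ≡ v ⊎ u ≼ w
  ≼-across-arc (inj₁ (_ , refl , refl)) ≼-refl        = inj₁ refl
  ≼-across-arc (inj₁ (_ , refl , refl)) (≼-child u≼v) = inj₂ u≼v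
  ≼-across-arc (inj₂ (_ , refl , refl)) u≼v           = inj₂ (≼-child u≼v)

  path-through-subtree-root : ∀ r → AllArcs (Arc T) r → v ∈ r → u ≼ v → w ∈ r → ¬ u ≼ w → u ∈ r
  path-through-subtree-root (x ∷ _) _ (here refl) u≼x (here refl) u⋠x = ⊥-elim (u⋠x u≼x)
  path-through-subtree-root (x ∷ []) _ (here _) _ (there ()) _
  path-through-subtree-root (x ∷ []) _ (there ()) _ _ _
  path-through-subtree-root (x ∷ y ∷ r) (_ , arcs) (there v∈) u≼v (there w∈) u⋠w =
    there (path-through-subtree-root (y ∷ r) arcs v∈ u≼v w∈ u⋠w)
  path-through-subtree-root (x ∷ y ∷ r) (xy , arcs) (here refl) u≼x (there w∈) u⋠w =
    [ here , (λ u≼y → there (path-through-subtree-root (y ∷ r) arcs (here refl) u≼y w∈ u⋠w)) ]′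
      (≼-across-arc xy u≼x)
  path-through-subtree-root {u = u} (x ∷ y ∷ r) (xy , arcs) (there v∈) u≼v (here refl) u⋠x =
    [ there ∘ here , (λ u≢y → there (path-through-subtree-root (y ∷ r) arcs v∈ u≼v (here refl)
                                       (λ u≼y → [ u≢y , u⋠x ] (≼-across-arc (swap xy) u≼y)))) ]′
      (toSum (u ≟ y))

  LastArc-∈-tail : LastArc T (u ∷ r) c d → d ∈ r
  LastArc-∈-tail ([]        , refl) = here refl
  LastArc-∈-tail (_ ∷ init , refl) = ∈-++⁺ʳ init (there (here refl))

  ConvergingOrUnimodal DivergingOrUnimodal : List (Vertex T) → Set
  ConvergingOrUnimodal r = Converging T r ⊎ Unimodal T r
  DivergingOrUnimodal  r = Diverging T r ⊎ Unimodal T r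

  StartsUpFrom EndsDownAt : List (Vertex T) → Fin n → Set
  StartsUpFrom r k = FirstArc T r (suc k) (parent k)
  EndsDownAt   r m = LastArc T r (parent m) (suc m)

  diverging⊎startsUp : IsDiPath T (u ∷ v ∷ r) →
                       Diverging T (u ∷ v ∷ r) ⊎ ∃[ k ] StartsUpFrom (u ∷ v ∷ r) k
  diverging⊎startsUp {r = r}     ((inj₁ (k , refl , refl) , _) , _) = inj₂ (k , r , refl)
  diverging⊎startsUp {r = []}    ((inj₂ uv , _) , _)                = inj₁ (uv , tt)
  diverging⊎startsUp {r = w ∷ r} ((inj₂ uv , arcs) , (_ ∷ u≢w ∷ _) ∷ uq)
    with diverging⊎startsUp (arcs , uq)
  ... | inj₁ div           = inj₁ (uv , div)
  ... | inj₂ (k , _ , refl) = ⊥-elim (u≢w (down-then-up-backtracks uv (k , refl , refl)))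

  converging⊎endsDown : IsDiPath T (u ∷ v ∷ r) →
                        Converging T (u ∷ v ∷ r) ⊎ ∃[ m ] EndsDownAt (u ∷ v ∷ r) m
  converging⊎endsDown {r = []} ((inj₁ uv , _) , _)                = inj₁ (uv , tt)
  converging⊎endsDown {r = []} ((inj₂ (m , refl , refl) , _) , _) = inj₂ (m , [] , refl)
  converging⊎endsDown {u = u} {r = w ∷ r} ((uv , arcs) , (_ ∷ u≢w ∷ _) ∷ uq)
    with converging⊎endsDown (arcs , uq)
  ... | inj₂ (m , init , e) = inj₂ (m , u ∷ init , cong (u ∷_) e)
  ... | inj₁ conv =
    [ (λ uv → inj₁ (uv , conv))
    , (λ vu → ⊥-elim (u≢w (down-then-up-backtracks vu (proj₁ conv)))) ] uv

  ¬converging×diverging : IsRequest T r → Converging T r → ¬ Diverging T r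
  ¬converging×diverging {[]}        (_ , ())
  ¬converging×diverging {_ ∷ []}    (_ , s≤s ())
  ¬converging×diverging {_ ∷ _ ∷ _} _ (uv , _) (vu , _) = convArc-asym uv vu

  unimodal-if-both : IsRequest T r → ConvergingOrUnimodal r → DivergingOrUnimodal r → Unimodal T r
  unimodal-if-both _  (inj₂ uni)  _          = uni
  unimodal-if-both _  (inj₁ _)    (inj₂ uni) = uni
  unimodal-if-both rq (inj₁ conv) (inj₁ div) = ⊥-elim (¬converging×diverging rq conv div)

  startsUp : IsRequest T r → ConvergingOrUnimodal r → ∃[ k ] StartsUpFrom r k
  startsUp {[]}        (_ , ()) _
  startsUp {_ ∷ []}    (_ , s≤s ()) _
  startsUp {_ ∷ _ ∷ _} rq cu with diverging⊎startsUp (proj₁ rq)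
  ... | inj₂ s   = s
  ... | inj₁ div =
    ⊥-elim ([ (λ conv → ¬converging×diverging rq conv div) , (λ uni → proj₂ uni div) ] cu)

  endsDown : IsRequest T r → DivergingOrUnimodal r → ∃[ m ] EndsDownAt r m
  endsDown {[]}        (_ , ()) _
  endsDown {_ ∷ []}    (_ , s≤s ()) _
  endsDown {_ ∷ _ ∷ _} rq du with converging⊎endsDown (proj₁ rq)
  ... | inj₂ e    = e
  ... | inj₁ conv = ⊥-elim ([ ¬converging×diverging rq conv , (λ uni → proj₁ uni conv) ] du)

  start⋠end : IsDiPath T r → StartsUpFrom r k → EndsDownAt r m → ¬ suc k ≼ suc m
  start⋠end ((_ , arcs) , sk∉ ∷ _) (_ , refl) end k≼m =
    All.lookup sk∉
      (path-through-subtree-root _ arcs (LastArc-∈-tail end) k≼m (here refl) child⋠parent) refl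

  end⋠start : IsDiPath T r → StartsUpFrom r k → EndsDownAt r m → ¬ suc m ≼ suc k
  end⋠start {m = m} (arcs , uq) (_ , e) (init , refl) m≼k =
    ∉-before (init ∷ʳ parent m) (subst Unique split uq)
      (path-through-subtree-root (init ∷ʳ parent m)
        (AllArcs-++⁻ˡ (init ∷ʳ parent m) (subst (AllArcs (Arc T)) split arcs))
        (head-∈-init init e) m≼k (∈-++⁺ʳ init (here refl)) child⋠parent)
    where
    split : init ++ parent m ∷ suc m ∷ [] ≡ (init ∷ʳ parent m) ++ suc m ∷ []
    split = sym (++-assoc init _ _)

  start-end-incomparable : IsDiPath T r → StartsUpFrom r k → EndsDownAt r m →
                           ¬ Comparable (suc k) (suc m)
  start-end-incomparable path s e = [ start⋠end path s e , end⋠start path s e ]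

  converging-lastArc : Converging T (u ∷ v ∷ r) →
                       ∃[ i ] suc i ≼ u × LastArc T (u ∷ v ∷ r) (suc i) (parent i)
  converging-lastArc {r = []}                ((i , refl , refl) , _) = i , ≼-refl , [] , refl
  converging-lastArc {u = u} {r = _ ∷ _} ((_ , refl , refl) , conv) =
    map₂ (λ (i≼v , init , e) → ≼-trans i≼v parent≼child , u ∷ init , cong (u ∷_) e)
         (converging-lastArc conv)

  diverging⇒head≼ : Diverging T (u ∷ r) → All (u ≼_) (u ∷ r)
  diverging⇒head≼ {r = []}    _                       = ≼-refl ∷ []
  diverging⇒head≼ {r = _ ∷ _} ((_ , refl , refl) , div) =
    ≼-refl ∷ All.map (≼-trans parent≼child) (diverging⇒head≼ div)

  interferes-via : FirstArc T r a b → LastArc T r′ c d → Route a b c d → InterferesOn T r r′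
  interferes-via first last (q , path , q-first , q-last) =
    q , path , (_ , _ , first , q-first) , (_ , _ , last , q-last)

  comparable-unless-interferes : StartsUpFrom r k → EndsDownAt r′ m → ¬ InterferesOn T r r′ →
                                 Comparable (suc k) (suc m)
  comparable-unless-interferes {k = k} {m = m} s e ¬i with placement (suc k) (suc m)
  ... | comparable cmp   = cmp
  ... | apart i≢j pe p q = ⊥-elim (¬i (interferes-via s e (route-apart i≢j pe p q)))

  interferes-from-below : IsRequest T r → ConvergingOrUnimodal r →
                          StartsUpFrom r k → StartsUpFrom r′ k′ → suc k ≼ suc k′ → InterferesOn T r′ r
  interferes-from-below _ (inj₁ conv) (_ , refl) s′ k≼k′
    with converging-lastArc conv
  ... | i , i≼k , last = interferes-via s′ last (route-up (≼-trans i≼k k≼k′))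
  interferes-from-below {k′ = k′} rq (inj₂ uni) s s′ k≼k′
    with endsDown rq (inj₂ uni)
  ... | m , e with placement (suc k′) (suc m)
  ...   | comparable (inj₁ k′≼m) =
    ⊥-elim (start-end-incomparable (proj₁ rq) s e (inj₁ (≼-trans k≼k′ k′≼m)))
  ...   | comparable (inj₂ m≼k′) =
    ⊥-elim (start-end-incomparable (proj₁ rq) s e (≼-linear k≼k′ m≼k′))
  ...   | apart i≢j pe p q       = interferes-via s′ e (route-apart i≢j pe p q)

  interferes-onto-below : IsRequest T r′ → DivergingOrUnimodal r′ →
                          EndsDownAt r′ m′ → EndsDownAt r m → suc m′ ≼ suc m → InterferesOn T r′ r
  interferes-onto-below {[]}        (_ , ())     _ _ _ _
  interferes-onto-below {_ ∷ []}    (_ , s≤s ()) _ _ _ _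
  interferes-onto-below {_ ∷ _ ∷ rest} _ (inj₁ ((_ , refl , refl) , div)) e′ e m′≼m =
    interferes-via (rest , refl) e
      (route-down (≼-trans (All.lookup (diverging⇒head≼ div) (LastArc-∈-tail e′)) m′≼m))
  interferes-onto-below {m = m} rq (inj₂ uni) e′ e m′≼m
    with startsUp rq (inj₂ uni)
  ... | k , s with placement (suc k) (suc m)
  ...   | comparable (inj₁ k≼m) =
    ⊥-elim (start-end-incomparable (proj₁ rq) s e′ (≼-linear k≼m m′≼m))
  ...   | comparable (inj₂ m≼k) =
    ⊥-elim (start-end-incomparable (proj₁ rq) s e′ (inj₂ (≼-trans m′≼m m≼k)))
  ...   | apart i≢j pe p q      = interferes-via s e (route-apart i≢j pe p q)

  ConvArc? : ∀ u v → Dec (ConvArc T u v)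
  ConvArc? zero    v = no λ { (_ , () , _) }
  ConvArc? (suc i) v with v ≟ parent i
  ... | yes refl = yes (i , refl , refl)
  ... | no  v≢pi = no λ { (_ , refl , v≡pi) → v≢pi v≡pi }

  Converging? : Decidable (Converging T)
  Converging? = AllArcs? ConvArc?

  Diverging? : Decidable (Diverging T)
  Diverging? = AllArcs? (λ u v → ConvArc? v u)

  Unimodal? : Decidable (Unimodal T)
  Unimodal? r = ¬? (Converging? r) ×-dec ¬? (Diverging? r)

  ConvergingOrUnimodal? : Decidable ConvergingOrUnimodal
  ConvergingOrUnimodal? r = Converging? r ⊎-dec Unimodal? r

  DivergingOrUnimodal? : Decidable DivergingOrUnimodal
  DivergingOrUnimodal? r = Diverging? r ⊎-dec Unimodal? r

  module _ (I : List (List (Vertex T)))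
           (isRequest : ∀ {r} → r ∈ I → IsRequest T r)
           (noInterference : ∀ {r r′} → r ∈ I → r′ ∈ I → r ≢ r′ → ¬ Interfere T r r′) where

    private variable
      x x′ y y′ : List (Vertex T)

    starts-incomparable : x ∈ I → ConvergingOrUnimodal x → x′ ∈ I → ConvergingOrUnimodal x′ →
                          x ≢ x′ → StartsUpFrom x k → StartsUpFrom x′ k′ → ¬ Comparable (suc k) (suc k′)
    starts-incomparable x∈ cx x′∈ cx′ x≢x′ s s′ (inj₁ k≼k′) =
      noInterference x′∈ x∈ (x≢x′ ∘ sym) (inj₁ (interferes-from-below (isRequest x∈) cx s s′ k≼k′))
    starts-incomparable x∈ cx x′∈ cx′ x≢x′ s s′ (inj₂ k′≼k) =
      noInterference x∈ x′∈ x≢x′ (inj₁ (interferes-from-below (isRequest x′∈) cx′ s′ s k′≼k))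

    ends-incomparable : y ∈ I → DivergingOrUnimodal y → y′ ∈ I → DivergingOrUnimodal y′ → y ≢ y′ →
                        EndsDownAt y m → EndsDownAt y′ m′ → ¬ Comparable (suc m) (suc m′)
    ends-incomparable y∈ dy y′∈ dy′ y≢y′ e e′ (inj₁ m≼m′) =
      noInterference y∈ y′∈ y≢y′ (inj₁ (interferes-onto-below (isRequest y∈) dy e e′ m≼m′))
    ends-incomparable y∈ dy y′∈ dy′ y≢y′ e e′ (inj₂ m′≼m) =
      noInterference y′∈ y∈ (y≢y′ ∘ sym)
        (inj₁ (interferes-onto-below (isRequest y′∈) dy′ e′ e m′≼m))

    start-end-comparable : x ∈ I → y ∈ I → x ≢ y → StartsUpFrom x k → EndsDownAt y m →
                           Comparable (suc k) (suc m)
    start-end-comparable x∈ y∈ x≢y s e =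
      comparable-unless-interferes s e (noInterference x∈ y∈ x≢y ∘ inj₁)

    -- x′ and y′ may coincide.
    two-by-two-impossible : x ∈ I → ConvergingOrUnimodal x → x′ ∈ I → ConvergingOrUnimodal x′ →
                            y ∈ I → DivergingOrUnimodal y → y′ ∈ I → DivergingOrUnimodal y′ →
                            x ≢ x′ → y ≢ y′ → x ≢ y → x ≢ y′ → x′ ≢ y → ⊥
    two-by-two-impossible x∈ cx x′∈ cx′ y∈ dy y′∈ dy′ x≢x′ y≢y′ x≢y x≢y′ x′≢y
      with startsUp (isRequest x∈) cx | startsUp (isRequest x′∈) cx′
         | endsDown (isRequest y∈) dy | endsDown (isRequest y′∈) dy′
    ... | _ , s | _ , s′ | _ , e | _ , e′ =
      crossing-impossible (starts-incomparable x∈ cx x′∈ cx′ x≢x′ s s′)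
                          (ends-incomparable y∈ dy y′∈ dy′ y≢y′ e e′)
                          (start-end-comparable x∈ y∈ x≢y s e)
                          (start-end-comparable x∈ y′∈ x≢y′ s e′)
                          (start-end-comparable x′∈ y∈ x′≢y s′ e)

    split : {P : List (Vertex T) → Set} → Decidable P → TwoDistinct P I ⊎ AllEqual P I
    split P? = twoDistinct⊎allEqual (≡-dec _≟_) P? I

    classification : ExactlyTwo (Unimodal T) I
                     ⊎ AllEqual DivergingOrUnimodal I ⊎ AllEqual ConvergingOrUnimodal I
    classification with split Unimodal? | split DivergingOrUnimodal? | split ConvergingOrUnimodal?
    ... | inj₁ (u₁ , u₂ , u₁≢u₂ , (u₁∈ , uni₁) , (u₂∈ , uni₂)) | _ | _ =
      inj₁ (u₁ , u₂ , u₁≢u₂ , u₁∈ , uni₁ , u₂∈ , uni₂ , only-two)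
      where
      only-two : ∀ {u} → u ∈ I → Unimodal T u → u ≡ u₁ ⊎ u ≡ u₂
      only-two {u} u∈ uni with ≡-dec _≟_ u u₁ | ≡-dec _≟_ u u₂
      ... | yes u≡u₁ | _        = inj₁ u≡u₁
      ... | no  _    | yes u≡u₂ = inj₂ u≡u₂
      ... | no  u≢u₁ | no  u≢u₂ =
        ⊥-elim (two-by-two-impossible u₁∈ (inj₂ uni₁) u₂∈ (inj₂ uni₂) u∈ (inj₂ uni) u₂∈ (inj₂ uni₂)
                                      u₁≢u₂ u≢u₂ (u≢u₁ ∘ sym) u₁≢u₂ (u≢u₂ ∘ sym))
    ... | inj₂ _ | inj₂ divEq | _ = inj₂ (inj₁ divEq)
    ... | inj₂ _ | inj₁ _ | inj₂ convEq = inj₂ (inj₂ convEq)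
    ... | inj₂ uniEq | inj₁ ys | inj₁ xs
      with oneOutside Unimodal? uniEq xs | oneOutside Unimodal? uniEq ys
    ... | x , x′ , x≢x′ , (x∈ , cx , ¬ux) , (x′∈ , cx′)
        | y , y′ , y≢y′ , (y∈ , dy , ¬uy) , (y′∈ , dy′) =
      ⊥-elim (two-by-two-impossible x∈ cx x′∈ cx′ y∈ dy y′∈ dy′ x≢x′ y≢y′ x≢y x≢y′ x′≢y)
      where
      x≢y : x ≢ y
      x≢y refl = ¬ux (unimodal-if-both (isRequest x∈) cx dy)
      x≢y′ : x ≢ y′
      x≢y′ refl = ¬ux (unimodal-if-both (isRequest x∈) cx dy′)
      x′≢y : x′ ≢ y
      x′≢y refl = ¬uy (unimodal-if-both (isRequest y∈) cx′ dy)

lemma6 : (T : RootedTree) (R I : List (List (Vertex T))) →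
    All (IsRequest T) R →
    I ⊆ R →
    (∀ {r r'} → r ∈ I → r' ∈ I → r ≢ r' → ¬ Interfere T r r') →
    (Σ (List (Vertex T)) λ u₁ → Σ (List (Vertex T)) λ u₂ →
        u₁ ≢ u₂ × u₁ ∈ I × Unimodal T u₁ × u₂ ∈ I × Unimodal T u₂ ×
        (∀ {u} → u ∈ I → Unimodal T u → u ≡ u₁ ⊎ u ≡ u₂))
    ⊎ (∀ {r r'} → r ∈ I → (Diverging T r ⊎ Unimodal T r) →
         r' ∈ I → (Diverging T r' ⊎ Unimodal T r') → r ≡ r')
    ⊎ (∀ {r r'} → r ∈ I → (Converging T r ⊎ Unimodal T r) →
         r' ∈ I → (Converging T r' ⊎ Unimodal T r') → r ≡ r')
lemma6 T R I requests I⊆R noInterference =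
  classification T I (All.lookup requests ∘ I⊆R) noInterference
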